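{- Let $G$ be a connected graph of maximum degree at most three which is not a path, and let $u$ be a support vertex of degree two with $N_G(u)=\{v,w\}$, where $v$ is a leaf and $w$ is not a support vertex. Let $G'=G-\{u,v\}$. If $G'$ is $(M',I')$-tractable for some matching $M'$ of $G'$ and independent set $I'$ of $G'$, then $G$ is $(M,I')$-tractable for some matching $M$ of $G$.
   Context: A leaf is a vertex of degree one; a support vertex is a vertex adjacent to a leaf. Let $[14]=\{1,\dots,14\}$. Given $F:V(G)\to 2^{[14]}$, an $F$-avoiding coloring of $G$ is $f:V(G)\to 2^{[14]}$ with $f(v)$ disjoint from $F(v)\cup f(u)$ for every pair of adjacent $u,v$. For a matching $M$ of $G$ saturating no support vertex, $F:V(G)\to 2^{[14]}$ obeys $M$ if (1) $|F(v)|\le 6-2\deg_G(v)$ for all $v$, (2) $F(v)\cap F(u)=\emptyset$ for every leaf $v$ and its neighbor $u$, and (3) $|F(x)\cap F(y)|\le 1$ for every $xy\in M$. $G$ is $(M,I)$-tractable if $M$ is a matching of $G$ saturating no support vertex, $I$ is an independent set of $G$ all of whose vertices have degree three in $G$, and for every $F$ obeying $M$ there exist $F$-avoiding colorings $f_1,f_2$ of $G$ (not necessarily distinct) with $|f_1(v)|+|f_2(v)|=16-2\deg_G(v)-2\cdot 1_I(v)$ for every $v\in V(G)$, where $1_I$ is the indicator function of $I$. -}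

module Defs where

open import Data.Nat using (ℕ; zero; suc; _+_; _*_; _≤_)
open import Data.Bool using (Bool; true; false; if_then_else_)
open import Data.Fin using (Fin; toℕ)
open import Data.Fin.Subset using (Subset; _∈_; _∉_; _⊆_; _∩_; _∪_; ⊥; ⊤; ∣_∣; _-_)
open import Data.Vec using (tabulate; lookup)
open import Data.Product using (Σ; ∃; ∃-syntax; _×_; _,_)
open import Data.Sum using (_⊎_)
open import Relation.Nullary using (¬_)
open import Relation.Binary.PropositionalEquality using (_≡_; _≢_)
open import Function.Definitions using (Bijective)
open import Function.Bundles using (_⇔_)

record Graph (n : ℕ) : Set where
  field
    adj    : Fin n → Fin n → Bool
    sym    : ∀ x y → adj x y ≡ adj y x
    irrefl : ∀ x → adj x x ≡ false

-- The colour palette [14] = {1,…,14}, represented as Fin 14.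
Colors : Set
Colors = Subset 14

Disjoint : Colors → Colors → Set
Disjoint A B = A ∩ B ≡ ⊥

module _ {n : ℕ} (G : Graph n) where
  open Graph G

  -- Everything below is about the induced subgraph G[S] of G on the
  -- vertex set S ⊆ V(G).  G itself is G[⊤].

  Edge : Subset n → Fin n → Fin n → Set
  Edge S x y = x ∈ S × y ∈ S × adj x y ≡ true

  nbhd : Fin n → Subset n
  nbhd v = tabulate (adj v)

  deg : Subset n → Fin n → ℕ
  deg S v = ∣ S ∩ nbhd v ∣

  Leaf : Subset n → Fin n → Set
  Leaf S v = v ∈ S × deg S v ≡ 1

  Support : Subset n → Fin n → Set
  Support S x = x ∈ S × ∃[ y ] (Edge S x y × Leaf S y)

  record IsMatching (S : Subset n) (M : Fin n → Fin n → Bool) : Set where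
    field
      edges  : ∀ x y → M x y ≡ true → Edge S x y
      msym   : ∀ x y → M x y ≡ M y x
      unique : ∀ x y z → M x y ≡ true → M x z ≡ true → y ≡ z

  Saturates : (Fin n → Fin n → Bool) → Fin n → Set
  Saturates M x = ∃[ y ] (M x y ≡ true)

  record IsIndep3 (S : Subset n) (I : Subset n) : Set where
    field
      sub   : I ⊆ S
      indep : ∀ x y → x ∈ I → y ∈ I → adj x y ≡ false
      deg3  : ∀ x → x ∈ I → deg S x ≡ 3

  ind : Subset n → Fin n → ℕ
  ind I v = if lookup I v then 1 else 0

  Obeys : Subset n → (Fin n → Fin n → Bool) → (Fin n → Colors) → Set
  Obeys S M F =
    (∀ v → v ∈ S → ∣ F v ∣ + 2 * deg S v ≤ 6) ×
    (∀ v u → Leaf S v → Edge S v u → Disjoint (F v) (F u)) ×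
    (∀ x y → M x y ≡ true → ∣ F x ∩ F y ∣ ≤ 1)

  Avoiding : Subset n → (Fin n → Colors) → (Fin n → Colors) → Set
  Avoiding S F f = ∀ u v → Edge S u v → Disjoint (f v) (F v ∪ f u)

  Tractable : Subset n → (Fin n → Fin n → Bool) → Subset n → Set
  Tractable S M I =
    IsMatching S M ×
    (∀ x → Support S x → ¬ Saturates M x) ×
    IsIndep3 S I ×
    (∀ (F : Fin n → Colors) → Obeys S M F →
       ∃[ f₁ ] ∃[ f₂ ] (Avoiding S F f₁ × Avoiding S F f₂ ×
         (∀ v → v ∈ S →
            ∣ f₁ v ∣ + ∣ f₂ v ∣ + 2 * deg S v + 2 * ind I v ≡ 16)))

  data Reach : Fin n → Fin n → Set where
    here : ∀ {x} → Reach x x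
    step : ∀ {x y z} → adj x y ≡ true → Reach y z → Reach x z

  Connected : Set
  Connected = ∀ x y → Reach x y

  IsPath : Set
  IsPath = Σ (Fin n → Fin n) λ σ → Bijective _≡_ _≡_ σ ×
    (∀ i j → (adj (σ i) (σ j) ≡ true) ⇔ (toℕ i ≡ suc (toℕ j) ⊎ toℕ j ≡ suc (toℕ i)))

  MaxDeg≤3 : Set
  MaxDeg≤3 = ∀ v → deg ⊤ v ≤ 3

module Submission where

open import Defs
open import Data.Nat using (ℕ; zero; suc; _+_; _*_; _∸_; _≤_; _<_; z≤n; s≤s; _≤?_)
open import Data.Nat.Properties hiding (_≟_)
open import Data.Nat.Tactic.RingSolver using (solve-∀)
open import Algebra.Properties.CommutativeSemigroup +-commutativeSemigroup using (interchange)
open import Data.Bool using (Bool; true; false)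
open import Data.Vec using (_∷_; []; here; there; lookup)
open import Data.Vec.Properties using (lookup∘tabulate; []=⇒lookup; lookup⇒[]=)
open import Data.Fin using (Fin; zero; suc; _≟_)
open import Data.Fin.Subset
open import Data.Fin.Subset.Properties
open import Data.Product using (∃-syntax; _×_; _,_; proj₁; proj₂)
open import Data.Sum using (_⊎_; inj₁; inj₂; [_,_]′)
open import Data.Empty using (⊥-elim)
open import Function using (_∘_)
open import Relation.Nullary using (¬_; yes; no)
open import Relation.Binary.PropositionalEquality

-- Let G′ = G - {u, v} (vertex set S′) and keep the
-- matching M′ and the independent set I′.

private variable
  n : ℕ
  p q A B C : Subset n

-- Pointwise disjointness; easier to use than the equational form A ∩ B ≡ ⊥.
Apart : Subset n → Subset n → Set
Apart A B = ∀ {c} → c ∈ A → c ∉ B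

apart⇒∩≡⊥ : Apart A B → A ∩ B ≡ ⊥
apart⇒∩≡⊥ {A = A} {B} d = Empty-unique λ (x , m) → let (a , b) = x∈p∩q⁻ A B m in d a b

∩≡⊥⇒apart : A ∩ B ≡ ⊥ → Apart A B
∩≡⊥⇒apart e a b = ∉⊥ (subst (_ ∈_) e (x∈p∩q⁺ (a , b)))

apart-∪ : Apart A B → Apart A C → Apart A (B ∪ C)
apart-∪ {B = B} {C = C} d e m z = [ d m , e m ]′ (x∈p∪q⁻ B C z)

apart-∪ˡ : Apart A (B ∪ C) → Apart A B
apart-∪ˡ d m z = d m (x∈p∪q⁺ (inj₁ z))

apart-∪ʳ : Apart A (B ∪ C) → Apart A C
apart-∪ʳ d m z = d m (x∈p∪q⁺ (inj₂ z))

apart-sym : Apart A B → Apart B A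
apart-sym d m z = d z m

x∈p─q⁻ : ∀ (p q : Subset n) {x} → x ∈ p ─ q → x ∈ p × x ∉ q
x∈p─q⁻ (true ∷ p) (false ∷ q) here = here , λ ()
x∈p─q⁻ (true ∷ p) (true ∷ q) {zero} ()
x∈p─q⁻ (false ∷ p) (true ∷ q) {zero} ()
x∈p─q⁻ (false ∷ p) (false ∷ q) {zero} ()
x∈p─q⁻ (_ ∷ p) (_ ∷ q) (there m) with x∈p─q⁻ p q m
... | a , z = there a , λ { (there k) → z k }

x∈p-y⁻ : ∀ (p : Subset n) y {x} → x ∈ p - y → x ∈ p × x ≢ y
x∈p-y⁻ p y m with x∈p─q⁻ p ⁅ y ⁆ m
... | a , b = a , λ { refl → b (x∈⁅x⁆ y) }

─-monoˡ : ∀ {X Y : Subset n} (Q : Subset n) → X ⊆ Y → X ─ Q ⊆ Y ─ Q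
─-monoˡ {X = X} Q s m = let (a , b) = x∈p─q⁻ X Q m in x∈p∧x∉q⇒x∈p─q (s a) b

∣p∪q∣+∣p∩q∣ : ∀ (p q : Subset n) → ∣ p ∪ q ∣ + ∣ p ∩ q ∣ ≡ ∣ p ∣ + ∣ q ∣
∣p∪q∣+∣p∩q∣ [] [] = refl
∣p∪q∣+∣p∩q∣ (true ∷ p) (true ∷ q) =
  cong suc (trans (+-suc _ _) (trans (cong suc (∣p∪q∣+∣p∩q∣ p q)) (sym (+-suc _ _))))
∣p∪q∣+∣p∩q∣ (true ∷ p) (false ∷ q) = cong suc (∣p∪q∣+∣p∩q∣ p q)
∣p∪q∣+∣p∩q∣ (false ∷ p) (true ∷ q) = trans (cong suc (∣p∪q∣+∣p∩q∣ p q)) (sym (+-suc _ _))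
∣p∪q∣+∣p∩q∣ (false ∷ p) (false ∷ q) = ∣p∪q∣+∣p∩q∣ p q

∣p─q∣+∣p∩q∣ : ∀ (p q : Subset n) → ∣ p ─ q ∣ + ∣ p ∩ q ∣ ≡ ∣ p ∣
∣p─q∣+∣p∩q∣ [] [] = refl
∣p─q∣+∣p∩q∣ (true ∷ p) (true ∷ q) = trans (+-suc _ _) (cong suc (∣p─q∣+∣p∩q∣ p q))
∣p─q∣+∣p∩q∣ (true ∷ p) (false ∷ q) = cong suc (∣p─q∣+∣p∩q∣ p q)
∣p─q∣+∣p∩q∣ (false ∷ p) (true ∷ q) = ∣p─q∣+∣p∩q∣ p q
∣p─q∣+∣p∩q∣ (false ∷ p) (false ∷ q) = ∣p─q∣+∣p∩q∣ p q

∣∁p∣+∣p∣ : ∀ (p : Subset n) → ∣ ∁ p ∣ + ∣ p ∣ ≡ n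
∣∁p∣+∣p∣ [] = refl
∣∁p∣+∣p∣ (true ∷ p) = trans (+-suc _ _) (cong suc (∣∁p∣+∣p∣ p))
∣∁p∣+∣p∣ (false ∷ p) = cong suc (∣∁p∣+∣p∣ p)

∣p∪q∣≤∣p∣+∣q∣ : ∀ (p q : Subset n) → ∣ p ∪ q ∣ ≤ ∣ p ∣ + ∣ q ∣
∣p∪q∣≤∣p∣+∣q∣ p q = subst (∣ p ∪ q ∣ ≤_) (∣p∪q∣+∣p∩q∣ p q) (m≤m+n _ _)

⊆⊇⇒∣∣≡ : p ⊆ q → q ⊆ p → ∣ p ∣ ≡ ∣ q ∣
⊆⊇⇒∣∣≡ a b = cong ∣_∣ (⊆-antisym a b)

∣p∩q∣≡∣q∩p∣ : ∀ (p q : Subset n) → ∣ p ∩ q ∣ ≡ ∣ q ∩ p ∣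
∣p∩q∣≡∣q∩p∣ p q = cong ∣_∣ (∩-comm p q)

noMember⇒∣∣≡0 : ∀ (p : Subset n) → (∀ x → x ∉ p) → ∣ p ∣ ≡ 0
noMember⇒∣∣≡0 [] h = refl
noMember⇒∣∣≡0 (true ∷ p) h = ⊥-elim (h zero here)
noMember⇒∣∣≡0 (false ∷ p) h = noMember⇒∣∣≡0 p (λ x m → h (suc x) (there m))

apart⇒∣∩∣≡0 : ∀ (A B : Subset n) → Apart A B → ∣ A ∩ B ∣ ≡ 0
apart⇒∣∩∣≡0 A B d = noMember⇒∣∣≡0 (A ∩ B) λ x m → let (a , b) = x∈p∩q⁻ A B m in d a b

∣p∪q∣-apart : ∀ (p q : Subset n) → Apart p q → ∣ p ∪ q ∣ ≡ ∣ p ∣ + ∣ q ∣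
∣p∪q∣-apart p q d =
  trans (sym (+-identityʳ _)) (trans (cong (∣ p ∪ q ∣ +_) (sym (apart⇒∣∩∣≡0 p q d))) (∣p∪q∣+∣p∩q∣ p q))

member⇒∣∣>0 : ∀ (p : Subset n) {x} → x ∈ p → 0 < ∣ p ∣
member⇒∣∣>0 (true ∷ p) _ = s≤s z≤n
member⇒∣∣>0 (false ∷ p) (there m) = member⇒∣∣>0 p m

∣∣>0⇒member : ∀ (p : Subset n) → 0 < ∣ p ∣ → ∃[ x ] x ∈ p
∣∣>0⇒member (true ∷ p) h = zero , here
∣∣>0⇒member (false ∷ p) h = let (x , m) = ∣∣>0⇒member p h in suc x , there m

∣p-x∣ : ∀ (p : Subset n) x → x ∈ p → suc ∣ p - x ∣ ≡ ∣ p ∣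
∣p-x∣ (true ∷ p) zero here = cong (suc ∘ ∣_∣) (p─⊥≡p p)
∣p-x∣ (true ∷ p) (suc x) (there m) = cong suc (∣p-x∣ p x m)
∣p-x∣ (false ∷ p) (suc x) (there m) = ∣p-x∣ p x m

record Singleton (p : Subset n) : Set where
  field
    elem  : Fin n
    elem∈ : elem ∈ p
    only  : ∀ {b} → b ∈ p → b ≡ elem

record Doubleton (p : Subset n) : Set where
  field
    first second : Fin n
    first∈  : first ∈ p
    second∈ : second ∈ p
    only : ∀ {c} → c ∈ p → c ≡ first ⊎ c ≡ second

∣∣≡1⇒unique : ∀ (p : Subset n) {a b} → ∣ p ∣ ≡ 1 → a ∈ p → b ∈ p → b ≡ a
∣∣≡1⇒unique p {a} {b} e ma mb with b ≟ a
... | yes q = q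
... | no q = ⊥-elim (<-irrefl (sym (suc-injective (trans (∣p-x∣ p a ma) e)))
                       (member⇒∣∣>0 (p - a) (x∈p∧x≢y⇒x∈p-y mb q)))

∣∣≡1⇒singleton : ∀ (p : Subset n) → ∣ p ∣ ≡ 1 → Singleton p
∣∣≡1⇒singleton p e =
  let (a , m) = ∣∣>0⇒member p (subst (0 <_) (sym e) (s≤s z≤n)) in
  record { elem = a ; elem∈ = m ; only = ∣∣≡1⇒unique p e m }

∣∣≡2⇒onlyTwo : ∀ (p : Subset n) {a b c} → ∣ p ∣ ≡ 2 → a ∈ p → b ∈ p → b ≢ a → c ∈ p →
               c ≡ a ⊎ c ≡ b
∣∣≡2⇒onlyTwo p {a} {b} {c} e ma mb b≢a mc with c ≟ a
... | yes c≡a = inj₁ c≡a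
... | no c≢a = inj₂ (∣∣≡1⇒unique (p - a) (suc-injective (trans (∣p-x∣ p a ma) e))
                       (x∈p∧x≢y⇒x∈p-y mb b≢a) (x∈p∧x≢y⇒x∈p-y mc c≢a))

∣∣≡2⇒doubleton : ∀ (p : Subset n) → ∣ p ∣ ≡ 2 → Doubleton p
∣∣≡2⇒doubleton p e =
  let (a , ma) = ∣∣>0⇒member p (subst (0 <_) (sym e) (s≤s z≤n))
      e′ = suc-injective (trans (∣p-x∣ p a ma) e)
      (b , mb) = ∣∣>0⇒member (p - a) (subst (0 <_) (sym e′) (s≤s z≤n))
      (b∈p , b≢a) = x∈p-y⁻ p a mb
  in record { first = a ; second = b ; first∈ = ma ; second∈ = b∈p
            ; only = ∣∣≡2⇒onlyTwo p e ma b∈p b≢a }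

sandwich : ∀ (p q : Subset n) k → p ⊆ q → ∣ p ∣ ≤ k → k ≤ ∣ q ∣ →
           ∃[ r ] (p ⊆ r × r ⊆ q × ∣ r ∣ ≡ k)
sandwich [] [] zero _ _ _ = [] , (λ m → m) , (λ m → m) , refl
sandwich (true ∷ p) (false ∷ q) k s _ _ with s here
... | ()
sandwich (true ∷ p) (true ∷ q) (suc k) s (s≤s a) (s≤s b) =
  let (r , pr , rq , e) = sandwich p q k (drop-∷-⊆ s) a b
  in true ∷ r , s⊆s pr , s⊆s rq , cong suc e
sandwich (false ∷ p) (false ∷ q) k s a b =
  let (r , pr , rq , e) = sandwich p q k (drop-∷-⊆ s) a b
  in false ∷ r , s⊆s pr , s⊆s rq , e
sandwich (false ∷ p) (true ∷ q) k s a b with k ≤? ∣ q ∣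
... | yes k≤ =
  let (r , pr , rq , e) = sandwich p q k (drop-∷-⊆ s) a k≤
  in false ∷ r , s⊆s pr , out⊆ rq , e
sandwich (false ∷ p) (true ∷ q) (suc k) s a (s≤s b) | no k≰ =
  let (r , pr , rq , e) = sandwich p q k (drop-∷-⊆ s)
                            (≤-trans (p⊆q⇒∣p∣≤∣q∣ (drop-∷-⊆ s)) (≤-pred (≰⇒> k≰))) b
  in true ∷ r , out⊆ pr , s⊆s rq , cong suc e
sandwich (false ∷ p) (true ∷ q) zero s a b | no k≰ = ⊥-elim (k≰ z≤n)

subsetOfSize : ∀ (q : Subset n) k → k ≤ ∣ q ∣ → ∃[ r ] (r ⊆ q × ∣ r ∣ ≡ k)
subsetOfSize {n} q k b =
  let (r , _ , rq , e) = sandwich ⊥ q k (⊆-min q) (≤-trans (≤-reflexive (∣⊥∣≡0 n)) z≤n) b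
  in r , rq , e

splitSum : ∀ {a₁ b₁ a₂ b₂ T} → a₁ ≤ b₁ → a₂ ≤ b₂ → a₁ + a₂ ≤ T → T ≤ b₁ + b₂ →
           ∃[ k₁ ] ∃[ k₂ ] (a₁ ≤ k₁ × k₁ ≤ b₁ × a₂ ≤ k₂ × k₂ ≤ b₂ × k₁ + k₂ ≡ T)
splitSum {a₁} {b₁} {a₂} {b₂} {T} h₁ h₂ lo hi with b₁ + a₂ ≤? T
... | yes h = b₁ , T ∸ b₁ , h₁ , ≤-refl ,
  m+n≤o⇒m≤o∸n a₂ (subst (_≤ T) (+-comm b₁ a₂) h) , m≤n+o⇒m∸n≤o T b₁ hi ,
  m+[n∸m]≡n (m+n≤o⇒m≤o b₁ h)
... | no h = T ∸ a₂ , a₂ , m+n≤o⇒m≤o∸n a₁ lo ,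
  m≤n+o⇒m∸n≤o T a₂ (subst (T ≤_) (+-comm b₁ a₂) (<⇒≤ (≰⇒> h))) , ≤-refl , h₂ ,
  m∸n+n≡m (m+n≤o⇒n≤o a₁ lo)

record Between (p₁ q₁ p₂ q₂ : Subset n) (t : ℕ) : Set where
  field
    r₁ r₂ : Subset n
    p₁⊆r₁ : p₁ ⊆ r₁
    r₁⊆q₁ : r₁ ⊆ q₁
    p₂⊆r₂ : p₂ ⊆ r₂
    r₂⊆q₂ : r₂ ⊆ q₂
    size  : ∣ r₁ ∣ + ∣ r₂ ∣ ≡ t

between : ∀ {p₁ q₁ p₂ q₂ : Subset n} t → p₁ ⊆ q₁ → p₂ ⊆ q₂ →
          ∣ p₁ ∣ + ∣ p₂ ∣ ≤ t → t ≤ ∣ q₁ ∣ + ∣ q₂ ∣ → Between p₁ q₁ p₂ q₂ t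
between {p₁ = p₁} {q₁} {p₂} {q₂} t s₁ s₂ lo hi =
  let (k₁ , k₂ , a₁ , b₁ , a₂ , b₂ , e) =
        splitSum (p⊆q⇒∣p∣≤∣q∣ s₁) (p⊆q⇒∣p∣≤∣q∣ s₂) lo hi
      (r₁ , pr₁ , rq₁ , e₁) = sandwich p₁ q₁ k₁ s₁ a₁ b₁
      (r₂ , pr₂ , rq₂ , e₂) = sandwich p₂ q₂ k₂ s₂ a₂ b₂
  in record { r₁ = r₁ ; r₂ = r₂ ; p₁⊆r₁ = pr₁ ; r₁⊆q₁ = rq₁ ; p₂⊆r₂ = pr₂ ; r₂⊆q₂ = rq₂
            ; size = trans (cong₂ _+_ e₁ e₂) e }

within : ∀ {q₁ q₂ : Subset n} t → t ≤ ∣ q₁ ∣ + ∣ q₂ ∣ → Between ⊥ q₁ ⊥ q₂ t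
within {n} {q₁} {q₂} t hi =
  between t (⊆-min q₁) (⊆-min q₂) (subst (_≤ t) (sym (cong₂ _+_ (∣⊥∣≡0 n) (∣⊥∣≡0 n))) z≤n) hi

complementsRoom : ∀ (A₁ A₂ : Subset n) K → ∣ A₁ ∣ + ∣ A₂ ∣ + K ≤ n + n →
                  K ≤ ∣ ∁ A₁ ∣ + ∣ ∁ A₂ ∣
complementsRoom {n} A₁ A₂ K h = +-cancelˡ-≤ (∣ A₁ ∣ + ∣ A₂ ∣) K (∣ ∁ A₁ ∣ + ∣ ∁ A₂ ∣) (begin
  ∣ A₁ ∣ + ∣ A₂ ∣ + K ≤⟨ h ⟩
  n + n ≡⟨ sym (cong₂ _+_ (∣∁p∣+∣p∣ A₁) (∣∁p∣+∣p∣ A₂)) ⟩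
  (∣ ∁ A₁ ∣ + ∣ A₁ ∣) + (∣ ∁ A₂ ∣ + ∣ A₂ ∣) ≡⟨ interchange (∣ ∁ A₁ ∣) _ _ _ ⟩
  (∣ ∁ A₁ ∣ + ∣ ∁ A₂ ∣) + (∣ A₁ ∣ + ∣ A₂ ∣) ≡⟨ +-comm _ (∣ A₁ ∣ + ∣ A₂ ∣) ⟩
  (∣ A₁ ∣ + ∣ A₂ ∣) + (∣ ∁ A₁ ∣ + ∣ ∁ A₂ ∣) ∎)
  where open ≤-Reasoning

record FewHits (Y₁ Y₂ Q : Subset n) (t h : ℕ) : Set where
  field
    W₁ W₂ : Subset n
    W₁⊆Y₁ : W₁ ⊆ Y₁
    W₂⊆Y₂ : W₂ ⊆ Y₂
    size  : ∣ W₁ ∣ + ∣ W₂ ∣ ≡ t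
    hits  : ∣ W₁ ∩ Q ∣ + ∣ W₂ ∩ Q ∣ ≤ h

-- Such sets exist if the Yᵢ have room for t elements and, outside Q, for t ∸ h.
-- Take the Wᵢ outside Q when possible; otherwise take all of Yᵢ ─ Q and top up.
fewHits : ∀ (Y₁ Y₂ Q : Subset n) t h → t ≤ ∣ Y₁ ∣ + ∣ Y₂ ∣ →
          t ≤ ∣ Y₁ ─ Q ∣ + ∣ Y₂ ─ Q ∣ + h → FewHits Y₁ Y₂ Q t h
fewHits Y₁ Y₂ Q t h room roomOutside with t ≤? ∣ Y₁ ─ Q ∣ + ∣ Y₂ ─ Q ∣
... | yes fits = record
  { W₁ = r₁ ; W₂ = r₂ ; W₁⊆Y₁ = p─q⊆p Y₁ Q ∘ r₁⊆q₁ ; W₂⊆Y₂ = p─q⊆p Y₂ Q ∘ r₂⊆q₂ ; size = size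
  ; hits = ≤-trans (≤-reflexive (cong₂ _+_ (noHits r₁⊆q₁) (noHits r₂⊆q₂))) z≤n }
  where
  open Between (within {q₁ = Y₁ ─ Q} {Y₂ ─ Q} t fits)
  noHits : ∀ {W Y} → W ⊆ Y ─ Q → ∣ W ∩ Q ∣ ≡ 0
  noHits {W} {Y} s = apart⇒∣∩∣≡0 W Q (λ m → proj₂ (x∈p─q⁻ Y Q (s m)))
... | no tooBig = record
  { W₁ = r₁ ; W₂ = r₂ ; W₁⊆Y₁ = r₁⊆q₁ ; W₂⊆Y₂ = r₂⊆q₂ ; size = size
  ; hits = +-cancelʳ-≤ (∣ Y₁ ─ Q ∣ + ∣ Y₂ ─ Q ∣) _ h (begin
      (∣ r₁ ∩ Q ∣ + ∣ r₂ ∩ Q ∣) + (∣ Y₁ ─ Q ∣ + ∣ Y₂ ─ Q ∣)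
        ≡⟨ interchange (∣ r₁ ∩ Q ∣) _ _ _ ⟩
      (∣ r₁ ∩ Q ∣ + ∣ Y₁ ─ Q ∣) + (∣ r₂ ∩ Q ∣ + ∣ Y₂ ─ Q ∣)
        ≡⟨ cong₂ _+_ (outsidePart p₁⊆r₁ r₁⊆q₁) (outsidePart p₂⊆r₂ r₂⊆q₂) ⟩
      ∣ r₁ ∣ + ∣ r₂ ∣ ≡⟨ size ⟩
      t ≤⟨ roomOutside ⟩
      ∣ Y₁ ─ Q ∣ + ∣ Y₂ ─ Q ∣ + h ≡⟨ +-comm _ h ⟩
      h + (∣ Y₁ ─ Q ∣ + ∣ Y₂ ─ Q ∣) ∎) }
  where
  open ≤-Reasoning
  open Between (between t (p─q⊆p Y₁ Q) (p─q⊆p Y₂ Q) (<⇒≤ (≰⇒> tooBig)) room)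
  outsidePart : ∀ {W Y} → Y ─ Q ⊆ W → W ⊆ Y → ∣ W ∩ Q ∣ + ∣ Y ─ Q ∣ ≡ ∣ W ∣
  outsidePart {W} {Y} YQ⊆W W⊆Y = begin-equality
    ∣ W ∩ Q ∣ + ∣ Y ─ Q ∣ ≡⟨ cong (∣ W ∩ Q ∣ +_) (⊆⊇⇒∣∣≡ (λ m → ─-monoˡ Q W⊆Y m)
         (λ m → x∈p∧x∉q⇒x∈p─q (YQ⊆W m) (proj₂ (x∈p─q⁻ Y Q m)))) ⟨
    ∣ W ∩ Q ∣ + ∣ W ─ Q ∣ ≡⟨ +-comm (∣ W ∩ Q ∣) _ ⟩
    ∣ W ─ Q ∣ + ∣ W ∩ Q ∣ ≡⟨ ∣p─q∣+∣p∩q∣ W Q ⟩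
    ∣ W ∣ ∎

roomOutside : ∀ (A₁ A₂ R Y₁ Y₂ Q : Subset n) t → A₁ ─ R ⊆ Y₁ ─ Q → A₂ ─ R ⊆ Y₂ ─ Q →
              ∣ A₁ ∩ R ∣ ≤ 2 → ∣ A₂ ∩ R ∣ ≤ 2 → ∣ A₁ ∣ + ∣ A₂ ∣ ≡ t + 2 →
              t ≤ ∣ Y₁ ─ Q ∣ + ∣ Y₂ ─ Q ∣ + 2
roomOutside A₁ A₂ R Y₁ Y₂ Q t s₁ s₂ h₁ h₂ e = +-cancelʳ-≤ 2 t _ (begin
  t + 2 ≡⟨ e ⟨
  ∣ A₁ ∣ + ∣ A₂ ∣ ≡⟨ cong₂ _+_ (∣p─q∣+∣p∩q∣ A₁ R) (∣p─q∣+∣p∩q∣ A₂ R) ⟨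
  (∣ A₁ ─ R ∣ + ∣ A₁ ∩ R ∣) + (∣ A₂ ─ R ∣ + ∣ A₂ ∩ R ∣) ≡⟨ interchange (∣ A₁ ─ R ∣) _ _ _ ⟩
  (∣ A₁ ─ R ∣ + ∣ A₂ ─ R ∣) + (∣ A₁ ∩ R ∣ + ∣ A₂ ∩ R ∣)
    ≤⟨ +-mono-≤ (+-mono-≤ (p⊆q⇒∣p∣≤∣q∣ s₁) (p⊆q⇒∣p∣≤∣q∣ s₂)) (+-mono-≤ h₁ h₂) ⟩
  (∣ Y₁ ─ Q ∣ + ∣ Y₂ ─ Q ∣) + 4 ≡⟨ +-assoc (∣ Y₁ ─ Q ∣ + ∣ Y₂ ─ Q ∣) 2 2 ⟨
  ∣ Y₁ ─ Q ∣ + ∣ Y₂ ─ Q ∣ + 2 + 2 ∎)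
  where open ≤-Reasoning

record Reservation (B Z : Subset n) (K h : ℕ) : Set where
  field
    X      : Subset n
    X⊆B─Z  : X ⊆ B ─ Z
    ∣X∣≤K  : ∣ X ∣ ≤ K
    ∣B─X∣≤h : ∣ B ─ X ∣ ≤ h

-- It exists when ∣ Z ∣ ≤ h and ∣ B ∣ ≤ K + h: take K elements of B ─ Z if there are
-- that many, and all of B ─ Z otherwise (then B ─ X ⊆ Z).
reserve : ∀ (B Z : Subset n) K h → ∣ Z ∣ ≤ h → ∣ B ∣ ≤ K + h → Reservation B Z K h
reserve B Z K h ∣Z∣≤h ∣B∣≤ with K ≤? ∣ B ─ Z ∣
... | yes enough =
  let (X , X⊆ , ∣X∣≡K) = subsetOfSize (B ─ Z) K enough
      ∣B∩X∣≡K = trans (⊆⊇⇒∣∣≡ (λ m → proj₂ (x∈p∩q⁻ B X m)) (λ m → x∈p∩q⁺ (p─q⊆p B Z (X⊆ m) , m))) ∣X∣≡K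
  in record { X = X ; X⊆B─Z = X⊆ ; ∣X∣≤K = ≤-reflexive ∣X∣≡K
            ; ∣B─X∣≤h = +-cancelʳ-≤ K (∣ B ─ X ∣) h (begin
                ∣ B ─ X ∣ + K ≡⟨ cong (∣ B ─ X ∣ +_) ∣B∩X∣≡K ⟨
                ∣ B ─ X ∣ + ∣ B ∩ X ∣ ≡⟨ ∣p─q∣+∣p∩q∣ B X ⟩
                ∣ B ∣ ≤⟨ ∣B∣≤ ⟩
                K + h ≡⟨ +-comm K h ⟩
                h + K ∎) }
  where open ≤-Reasoning
... | no few = record { X = B ─ Z ; X⊆B─Z = λ m → m ; ∣X∣≤K = <⇒≤ (≰⇒> few)
                      ; ∣B─X∣≤h = ≤-trans (p⊆q⇒∣p∣≤∣q∣ inZ) ∣Z∣≤h }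
  where
  inZ : B ─ (B ─ Z) ⊆ Z
  inZ {c} m with x∈p─q⁻ B (B ─ Z) m | c ∈? Z
  ... | _ | yes c∈Z = c∈Z
  ... | c∈B , c∉B─Z | no c∉Z = ⊥-elim (c∉B─Z (x∈p∧x∉q⇒x∈p─q c∈B c∉Z))

record PendantColours (P Q W₁ W₂ : Subset 14) : Set where
  field
    U₁ U₂ V₁ V₂ : Subset 14
    U₁-apart : Apart U₁ (P ∪ W₁)
    U₂-apart : Apart U₂ (P ∪ W₂)
    V₁-apart : Apart V₁ (Q ∪ U₁)
    V₂-apart : Apart V₂ (Q ∪ U₂)
    ∣U∣ : ∣ U₁ ∣ + ∣ U₂ ∣ ≡ 12
    ∣V∣ : ∣ V₁ ∣ + ∣ V₂ ∣ ≡ 14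

-- The colours of u and v can be chosen once those of w (the Wᵢ) are fixed, provided
-- the lists P = F u, Q = F v are apart, ∣ Q ∣ ≤ 4, the Wᵢ meet Q in at most two colours
-- in total and ∣ P ∪ W₁ ∣ + ∣ P ∪ W₂ ∣ ≤ 16.  The Uᵢ are chosen to contain Q ─ Wᵢ,
-- which leaves Q ∪ Uᵢ small enough for the Vᵢ.
pendantColours : ∀ (P Q W₁ W₂ : Subset 14) → Apart Q P → ∣ Q ∣ ≤ 4 →
                 ∣ W₁ ∩ Q ∣ + ∣ W₂ ∩ Q ∣ ≤ 2 → ∣ P ∪ W₁ ∣ + ∣ P ∪ W₂ ∣ ≤ 16 →
                 PendantColours P Q W₁ W₂
pendantColours P Q W₁ W₂ Q#P ∣Q∣≤4 hits ∣P∪W∣ = record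
  { U₁ = U.r₁ ; U₂ = U.r₂ ; V₁ = V.r₁ ; V₂ = V.r₂
  ; U₁-apart = x∈∁p⇒x∉p ∘ U.r₁⊆q₁ ; U₂-apart = x∈∁p⇒x∉p ∘ U.r₂⊆q₂
  ; V₁-apart = x∈∁p⇒x∉p ∘ V.r₁⊆q₁ ; V₂-apart = x∈∁p⇒x∉p ∘ V.r₂⊆q₂
  ; ∣U∣ = U.size ; ∣V∣ = V.size }
  where
  forced⊆free : ∀ W → Q ─ W ⊆ ∁ (P ∪ W)
  forced⊆free W m = let (a , b) = x∈p─q⁻ Q W m in
    x∉p⇒x∈∁p (λ z → [ Q#P a , b ]′ (x∈p∪q⁻ P W z))
  module U = Between (between {p₁ = Q ─ W₁} {∁ (P ∪ W₁)} {Q ─ W₂} {∁ (P ∪ W₂)} 12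
    (forced⊆free W₁) (forced⊆free W₂)
    (≤-trans (+-mono-≤ (≤-trans (∣p─q∣≤∣p∣ Q W₁) ∣Q∣≤4) (≤-trans (∣p─q∣≤∣p∣ Q W₂) ∣Q∣≤4))
      (m≤m+n 8 4))
    (complementsRoom (P ∪ W₁) (P ∪ W₂) 12 (+-monoˡ-≤ 12 ∣P∪W∣)))
  ∣Q∪U∣≤ : ∀ W U → Q ─ W ⊆ U → ∣ Q ∪ U ∣ ≤ ∣ W ∩ Q ∣ + ∣ U ∣
  ∣Q∪U∣≤ W U QW⊆U = +-cancelʳ-≤ (∣ Q ∩ U ∣) _ _ (begin
    ∣ Q ∪ U ∣ + ∣ Q ∩ U ∣ ≡⟨ ∣p∪q∣+∣p∩q∣ Q U ⟩
    ∣ Q ∣ + ∣ U ∣ ≡⟨ cong (_+ ∣ U ∣) (trans (sym (∣p─q∣+∣p∩q∣ Q W)) (+-comm _ (∣ Q ∩ W ∣))) ⟩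
    (∣ Q ∩ W ∣ + ∣ Q ─ W ∣) + ∣ U ∣ ≤⟨ +-monoˡ-≤ (∣ U ∣) (+-mono-≤ (≤-reflexive (∣p∩q∣≡∣q∩p∣ Q W))
                                         (p⊆q⇒∣p∣≤∣q∣ (λ m → x∈p∩q⁺ (p─q⊆p Q W m , QW⊆U m)))) ⟩
    (∣ W ∩ Q ∣ + ∣ Q ∩ U ∣) + ∣ U ∣ ≡⟨ +-assoc (∣ W ∩ Q ∣) _ _ ⟩
    ∣ W ∩ Q ∣ + (∣ Q ∩ U ∣ + ∣ U ∣) ≡⟨ cong (∣ W ∩ Q ∣ +_) (+-comm (∣ Q ∩ U ∣) _) ⟩
    ∣ W ∩ Q ∣ + (∣ U ∣ + ∣ Q ∩ U ∣) ≡⟨ +-assoc (∣ W ∩ Q ∣) _ _ ⟨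
    ∣ W ∩ Q ∣ + ∣ U ∣ + ∣ Q ∩ U ∣ ∎)
    where open ≤-Reasoning
  ∣Q∪U∣-total : ∣ Q ∪ U.r₁ ∣ + ∣ Q ∪ U.r₂ ∣ ≤ 14
  ∣Q∪U∣-total = begin
    ∣ Q ∪ U.r₁ ∣ + ∣ Q ∪ U.r₂ ∣ ≤⟨ +-mono-≤ (∣Q∪U∣≤ W₁ U.r₁ U.p₁⊆r₁) (∣Q∪U∣≤ W₂ U.r₂ U.p₂⊆r₂) ⟩
    (∣ W₁ ∩ Q ∣ + ∣ U.r₁ ∣) + (∣ W₂ ∩ Q ∣ + ∣ U.r₂ ∣) ≡⟨ interchange (∣ W₁ ∩ Q ∣) _ _ _ ⟩
    (∣ W₁ ∩ Q ∣ + ∣ W₂ ∩ Q ∣) + (∣ U.r₁ ∣ + ∣ U.r₂ ∣) ≤⟨ +-mono-≤ hits (≤-reflexive U.size) ⟩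
    14 ∎
    where open ≤-Reasoning
  module V = Between (within {q₁ = ∁ (Q ∪ U.r₁)} {∁ (Q ∪ U.r₂)} 14
    (complementsRoom (Q ∪ U.r₁) (Q ∪ U.r₂) 14 (+-monoˡ-≤ 14 ∣Q∪U∣-total)))

-- Arithmetic for the case where w is a leaf of G; it is used with y = ∣ ∁ (F w ∪ F u) ∣,
-- a = ∣ F w ∣, p = ∣ F u ∣, r = ∣ ∁ (F w ∪ F u) ─ F v ∣ and t = 14 - 2p.
leafCase-room : ∀ {y a p r t} → y + (a + p) ≡ 14 → a ≤ 4 → y ≤ r + 4 → (p + p) + t ≡ 14 →
                t ≤ y + y × t ≤ r + r + 2
leafCase-room {y} {a} {p} {r} {t} e a≤4 y≤r+4 et =
  +-cancelˡ-≤ (p + p) t (y + y) (begin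
    (p + p) + t ≡⟨ et ⟩
    14 ≤⟨ m≤m+n 14 6 ⟩
    10 + 10 ≤⟨ +-mono-≤ 10≤y+p 10≤y+p ⟩
    (y + p) + (y + p) ≡⟨ rearrange₁ y p ⟩
    (p + p) + (y + y) ∎) ,
  +-cancelˡ-≤ (p + p) t (r + r + 2) (begin
    (p + p) + t ≡⟨ et ⟩
    6 + 6 + 2 ≤⟨ +-monoˡ-≤ 2 (+-mono-≤ 6≤r+p 6≤r+p) ⟩
    (r + p) + (r + p) + 2 ≡⟨ rearrange₂ r p ⟩
    (p + p) + (r + r + 2) ∎)
  where
  open ≤-Reasoning
  rearrange₁ : ∀ y p → (y + p) + (y + p) ≡ (p + p) + (y + y)
  rearrange₁ = solve-∀
  rearrange₂ : ∀ r p → (r + p) + (r + p) + 2 ≡ (p + p) + (r + r + 2)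
  rearrange₂ = solve-∀
  rearrange₃ : ∀ y p → y + (4 + p) ≡ (y + p) + 4
  rearrange₃ = solve-∀
  10≤y+p : 10 ≤ y + p
  10≤y+p = +-cancelʳ-≤ 4 10 (y + p) (begin
    14 ≡⟨ e ⟨
    y + (a + p) ≤⟨ +-monoʳ-≤ y (+-monoˡ-≤ p a≤4) ⟩
    y + (4 + p) ≡⟨ rearrange₃ y p ⟩
    (y + p) + 4 ∎)
  6≤r+p : 6 ≤ r + p
  6≤r+p = +-cancelʳ-≤ 4 6 (r + p) (begin
    10 ≤⟨ 10≤y+p ⟩
    y + p ≤⟨ +-monoˡ-≤ p y≤r+4 ⟩
    (r + 4) + p ≡⟨ +-assoc r 4 p ⟩
    r + (4 + p) ≡⟨ rearrange₃ r p ⟩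
    (r + p) + 4 ∎)

true≢false : true ≢ false
true≢false ()

1≢0 : 1 ≢ 0
1≢0 ()

1≢2 : 1 ≢ 2
1≢2 ()

ind-∉ : ∀ {n} (G : Graph n) (I : Subset n) z → z ∉ I → ind G I z ≡ 0
ind-∉ G I z z∉I with lookup I z in eq
... | false = refl
... | true = ⊥-elim (z∉I (lookup⇒[]= z I eq))

module PendantPath {n : ℕ} (G : Graph n) (maxDeg : MaxDeg≤3 G)
  (u v w : Fin n) (v≢w : v ≢ w) (uv : Graph.adj G u v ≡ true) (uw : Graph.adj G u w ≡ true)
  (deg-u : deg G ⊤ u ≡ 2) (leaf-v : Leaf G ⊤ v) (w-noSupport : ¬ Support G ⊤ w) where

  open Graph G using (adj)

  S′ : Subset n
  S′ = (⊤ - u) - v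

  adj-sym : ∀ {x y} → adj x y ≡ true → adj y x ≡ true
  adj-sym {x} {y} e = trans (Graph.sym G y x) e

  adj⇒≢ : ∀ {x y} → adj x y ≡ true → x ≢ y
  adj⇒≢ {x} e refl with trans (sym e) (Graph.irrefl G x)
  ... | ()

  adj⇒∈nbhd : ∀ {S x y} → y ∈ S → adj x y ≡ true → y ∈ S ∩ nbhd G x
  adj⇒∈nbhd {x = x} {y} y∈S e =
    x∈p∩q⁺ (y∈S , lookup⇒[]= y (nbhd G x) (trans (lookup∘tabulate (adj x) y) e))

  ∈nbhd⇒adj : ∀ {S x y} → y ∈ S ∩ nbhd G x → y ∈ S × adj x y ≡ true
  ∈nbhd⇒adj {S} {x} {y} m = let (a , b) = x∈p∩q⁻ S (nbhd G x) m in
    a , trans (sym (lookup∘tabulate (adj x) y)) ([]=⇒lookup b)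

  ∈S′ : ∀ {z} → z ≢ u → z ≢ v → z ∈ S′
  ∈S′ z≢u z≢v = x∈p∧x≢y⇒x∈p-y (x∈p∧x≢y⇒x∈p-y ∈⊤ z≢u) z≢v

  ∈S′⁻ : ∀ {z} → z ∈ S′ → z ≢ u × z ≢ v
  ∈S′⁻ m = let (a , b) = x∈p-y⁻ (⊤ - u) v m in proj₂ (x∈p-y⁻ ⊤ u a) , b

  u≢v : u ≢ v
  u≢v = adj⇒≢ uv

  u≢w : u ≢ w
  u≢w = adj⇒≢ uw

  w∈S′ : w ∈ S′
  w∈S′ = ∈S′ (λ q → u≢w (sym q)) (λ q → v≢w (sym q))

  nbr-v : ∀ {z} → adj v z ≡ true → z ≡ u
  nbr-v e = ∣∣≡1⇒unique (⊤ ∩ nbhd G v) (proj₂ leaf-v) (adj⇒∈nbhd ∈⊤ (adj-sym uv)) (adj⇒∈nbhd ∈⊤ e)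

  nbr-u : ∀ {z} → adj u z ≡ true → z ≡ v ⊎ z ≡ w
  nbr-u e = ∣∣≡2⇒onlyTwo (⊤ ∩ nbhd G u) deg-u (adj⇒∈nbhd ∈⊤ uv) (adj⇒∈nbhd ∈⊤ uw)
              (λ q → v≢w (sym q)) (adj⇒∈nbhd ∈⊤ e)

  -- Hence a vertex of G′ other than w sees no vertex outside G′ and keeps its degree.
  deg-S′ : ∀ {z} → z ∈ S′ → z ≢ w → deg G S′ z ≡ deg G ⊤ z
  deg-S′ {z} z∈S′ z≢w = ⊆⊇⇒∣∣≡ (λ m → x∈p∩q⁺ (∈⊤ , proj₂ (x∈p∩q⁻ S′ (nbhd G z) m)))
    (λ m → let (_ , e) = ∈nbhd⇒adj {⊤} m in adj⇒∈nbhd (∈S′ (≢u e) (≢v e)) e)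
    where
    ≢u : ∀ {y} → adj z y ≡ true → y ≢ u
    ≢u e refl = [ proj₂ (∈S′⁻ z∈S′) , z≢w ]′ (nbr-u (adj-sym e))
    ≢v : ∀ {y} → adj z y ≡ true → y ≢ v
    ≢v e refl = proj₁ (∈S′⁻ z∈S′) (nbr-v (adj-sym e))

  deg-w : deg G ⊤ w ≡ suc (deg G S′ w)
  deg-w = trans (sym (∣p-x∣ (⊤ ∩ nbhd G w) u (adj⇒∈nbhd ∈⊤ (adj-sym uw))))
    (cong suc (⊆⊇⇒∣∣≡
      (λ m → let (a , y≢u) = x∈p-y⁻ (⊤ ∩ nbhd G w) u m
                 (_ , e) = ∈nbhd⇒adj {⊤} a in
             adj⇒∈nbhd (∈S′ y≢u (λ { refl → u≢w (sym (nbr-v (adj-sym e))) })) e)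
      (λ m → let (a , e) = ∈nbhd⇒adj {S′} m in
             x∈p∧x≢y⇒x∈p-y (adj⇒∈nbhd ∈⊤ e) (proj₁ (∈S′⁻ a)))))

  deg′-w≤2 : deg G S′ w ≤ 2
  deg′-w≤2 = ≤-pred (subst (_≤ 3) deg-w (maxDeg w))

  leaf⁺ : ∀ {z} → z ∈ S′ → z ≢ w → Leaf G S′ z → Leaf G ⊤ z
  leaf⁺ z∈S′ z≢w (_ , e) = ∈⊤ , trans (sym (deg-S′ z∈S′ z≢w)) e

  leaf⁻ : ∀ {z} → z ∈ S′ → z ≢ w → Leaf G ⊤ z → Leaf G S′ z
  leaf⁻ z∈S′ z≢w (_ , e) = z∈S′ , trans (deg-S′ z∈S′ z≢w) e

  -- Since w is not a support vertex, its neighbours in G′ are not leaves of G.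
  nbr-w-deg≥2 : ∀ {x} → adj w x ≡ true → 2 ≤ deg G ⊤ x
  nbr-w-deg≥2 {x} e with deg G ⊤ x in eq
  ... | 0 = ⊥-elim (<-irrefl (sym eq) (member⇒∣∣>0 (⊤ ∩ nbhd G x) (adj⇒∈nbhd ∈⊤ (adj-sym e))))
  ... | 1 = ⊥-elim (w-noSupport (∈⊤ , x , (∈⊤ , ∈⊤ , e) , (∈⊤ , eq)))
  ... | suc (suc _) = s≤s (s≤s z≤n)

  data Place : Fin n → Set where
    at-u : Place u
    at-v : Place v
    at-w : Place w
    elsewhere : ∀ {z} → z ∈ S′ → z ≢ w → Place z

  place : ∀ z → Place z
  place z with z ≟ u | z ≟ v | z ≟ w
  ... | yes refl | _ | _ = at-u
  ... | no _ | yes refl | _ = at-v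
  ... | no _ | no _ | yes refl = at-w
  ... | no z≢u | no z≢v | no z≢w = elsewhere (∈S′ z≢u z≢v) z≢w

  module Extension (M′ : Fin n → Fin n → Bool) (I′ : Subset n)
    (matching′ : IsMatching G S′ M′)
    (unsaturated′ : ∀ x → Support G S′ x → ¬ Saturates G M′ x)
    (indep′ : IsIndep3 G S′ I′) where

    M′-edge : ∀ {x y} → M′ x y ≡ true → x ∈ S′ × y ∈ S′ × adj x y ≡ true
    M′-edge {x} {y} = IsMatching.edges matching′ x y

    matching : IsMatching G ⊤ M′
    matching = record
      { edges = λ x y e → let (_ , _ , a) = M′-edge e in ∈⊤ , ∈⊤ , a
      ; msym = IsMatching.msym matching′ ; unique = IsMatching.unique matching′ }

    -- A support vertex of G saturated by M′ would lie in G′ and have a leaf neighbour y;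
    -- y is not u (degree 2), not v or w (their only neighbour u is outside G′),
    -- so y is a leaf of G′ and x a support vertex of G′.
    unsaturated : ∀ x → Support G ⊤ x → ¬ Saturates G M′ x
    unsaturated x (_ , y , (_ , _ , xy) , leaf-y) (z , xz) with M′-edge xz | place y
    ... | _ | at-u = 1≢2 (trans (sym (proj₂ leaf-y)) deg-u)
    ... | x∈S′ , _ | at-v = proj₁ (∈S′⁻ x∈S′) (nbr-v (adj-sym xy))
    ... | x∈S′ , _ | at-w = proj₁ (∈S′⁻ x∈S′)
          (∣∣≡1⇒unique (⊤ ∩ nbhd G w) (proj₂ leaf-y) (adj⇒∈nbhd ∈⊤ (adj-sym uw)) (adj⇒∈nbhd ∈⊤ (adj-sym xy)))
    ... | x∈S′ , _ | elsewhere y∈S′ y≢w =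
          unsaturated′ x (x∈S′ , y , (x∈S′ , y∈S′ , xy) , leaf⁻ y∈S′ y≢w leaf-y) (z , xz)

    -- w ∉ I′ since its degree in G′ is at most 2; other vertices keep their degree.
    indep : IsIndep3 G ⊤ I′
    indep = record { sub = λ _ → ∈⊤ ; indep = IsIndep3.indep indep′ ; deg3 = deg3 }
      where
      deg3 : ∀ x → x ∈ I′ → deg G ⊤ x ≡ 3
      deg3 x x∈I′ with x ≟ w
      ... | yes x≡w = ⊥-elim (<-irrefl (IsIndep3.deg3 indep′ x x∈I′)
                               (s≤s (subst (λ y → deg G S′ y ≤ 2) (sym x≡w) deg′-w≤2)))
      ... | no x≢w = trans (sym (deg-S′ (IsIndep3.sub indep′ x∈I′) x≢w)) (IsIndep3.deg3 indep′ x x∈I′)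

    ind-u : ind G I′ u ≡ 0
    ind-u = ind-∉ G I′ u (λ m → proj₁ (∈S′⁻ (IsIndep3.sub indep′ m)) refl)

    ind-v : ind G I′ v ≡ 0
    ind-v = ind-∉ G I′ v (λ m → proj₂ (∈S′⁻ (IsIndep3.sub indep′ m)) refl)

    ind-w : ind G I′ w ≡ 0
    ind-w = ind-∉ G I′ w (λ m → <-irrefl (IsIndep3.deg3 indep′ w m) (s≤s deg′-w≤2))

    record TwoColourings (S : Subset n) (F : Fin n → Colors) : Set where
      field
        f₁ f₂  : Fin n → Colors
        avoid₁ : Avoiding G S F f₁
        avoid₂ : Avoiding G S F f₂
        sizes  : ∀ z → z ∈ S → ∣ f₁ z ∣ + ∣ f₂ z ∣ + 2 * deg G S z + 2 * ind G I′ z ≡ 16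

    _[w≔_] : (Fin n → Colors) → Colors → Fin n → Colors
    (F [w≔ X ]) z with z ≟ w
    ... | yes _ = X
    ... | no _ = F z

    ≔-at-w : ∀ F X → (F [w≔ X ]) w ≡ X
    ≔-at-w F X with w ≟ w
    ... | yes _ = refl
    ... | no w≢w = ⊥-elim (w≢w refl)

    ≔-off-w : ∀ F X {z} → z ≢ w → (F [w≔ X ]) z ≡ F z
    ≔-off-w F X {z} z≢w with z ≟ w
    ... | yes z≡w = ⊥-elim (z≢w z≡w)
    ... | no _ = refl

    obeys′ : ∀ F → Obeys G ⊤ M′ F → (X : Colors) →
      ∣ X ∣ + 2 * deg G S′ w ≤ 6 →
      (∀ b → Leaf G S′ w → Edge G S′ w b → Disjoint X (F b)) →
      (∀ b → M′ w b ≡ true → ∣ X ∩ F b ∣ ≤ 1) →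
      Obeys G S′ M′ (F [w≔ X ])
    obeys′ F (size-ok , leaf-ok , match-ok) X size-w leaf-w match-w = size′ , leaf′ , match′
      where
      size′ : ∀ z → z ∈ S′ → ∣ (F [w≔ X ]) z ∣ + 2 * deg G S′ z ≤ 6
      size′ z z∈S′ with place z
      ... | at-u = ⊥-elim (proj₁ (∈S′⁻ z∈S′) refl)
      ... | at-v = ⊥-elim (proj₂ (∈S′⁻ z∈S′) refl)
      ... | at-w rewrite ≔-at-w F X = size-w
      ... | elsewhere _ z≢w rewrite ≔-off-w F X z≢w | deg-S′ z∈S′ z≢w = size-ok z ∈⊤
      leaf′ : ∀ a b → Leaf G S′ a → Edge G S′ a b → Disjoint ((F [w≔ X ]) a) ((F [w≔ X ]) b)
      leaf′ a b leaf-a (a∈S′ , b∈S′ , ab) with place a | place b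
      ... | at-u | _ = ⊥-elim (proj₁ (∈S′⁻ a∈S′) refl)
      ... | at-v | _ = ⊥-elim (proj₂ (∈S′⁻ a∈S′) refl)
      ... | _ | at-u = ⊥-elim (proj₁ (∈S′⁻ b∈S′) refl)
      ... | _ | at-v = ⊥-elim (proj₂ (∈S′⁻ b∈S′) refl)
      ... | at-w | at-w = ⊥-elim (adj⇒≢ ab refl)
      ... | at-w | elsewhere _ b≢w rewrite ≔-at-w F X | ≔-off-w F X b≢w =
            leaf-w b leaf-a (a∈S′ , b∈S′ , ab)
      ... | elsewhere _ a≢w | at-w =
            ⊥-elim (w-noSupport (∈⊤ , a , (∈⊤ , ∈⊤ , adj-sym ab) , leaf⁺ a∈S′ a≢w leaf-a))
      ... | elsewhere _ a≢w | elsewhere _ b≢w rewrite ≔-off-w F X a≢w | ≔-off-w F X b≢w =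
            leaf-ok a b (leaf⁺ a∈S′ a≢w leaf-a) (∈⊤ , ∈⊤ , ab)
      match′ : ∀ a b → M′ a b ≡ true → ∣ (F [w≔ X ]) a ∩ (F [w≔ X ]) b ∣ ≤ 1
      match′ a b ab with M′-edge ab | place a | place b
      ... | a∈S′ , _ | at-u | _ = ⊥-elim (proj₁ (∈S′⁻ a∈S′) refl)
      ... | a∈S′ , _ | at-v | _ = ⊥-elim (proj₂ (∈S′⁻ a∈S′) refl)
      ... | _ , b∈S′ , _ | _ | at-u = ⊥-elim (proj₁ (∈S′⁻ b∈S′) refl)
      ... | _ , b∈S′ , _ | _ | at-v = ⊥-elim (proj₂ (∈S′⁻ b∈S′) refl)
      ... | _ , _ , e | at-w | at-w = ⊥-elim (adj⇒≢ e refl)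
      ... | _ | at-w | elsewhere _ b≢w rewrite ≔-at-w F X | ≔-off-w F X b≢w = match-w b ab
      ... | _ | elsewhere _ a≢w | at-w rewrite ≔-at-w F X | ≔-off-w F X a≢w =
            subst (_≤ 1) (∣p∩q∣≡∣q∩p∣ X (F a)) (match-w a (trans (IsMatching.msym matching′ w a) ab))
      ... | _ | elsewhere _ a≢w | elsewhere _ b≢w rewrite ≔-off-w F X a≢w | ≔-off-w F X b≢w =
            match-ok a b ab

    glue : (Fin n → Colors) → (W U V : Colors) → Fin n → Colors
    glue g W U V z with z ≟ u | z ≟ v | z ≟ w
    ... | yes _ | _ | _ = U
    ... | no _ | yes _ | _ = V
    ... | no _ | no _ | yes _ = W
    ... | no _ | no _ | no _ = g z

    glue-u : ∀ g W U V → glue g W U V u ≡ U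
    glue-u g W U V with u ≟ u
    ... | yes _ = refl
    ... | no u≢u = ⊥-elim (u≢u refl)

    glue-v : ∀ g W U V → glue g W U V v ≡ V
    glue-v g W U V with v ≟ u | v ≟ v
    ... | yes v≡u | _ = ⊥-elim (u≢v (sym v≡u))
    ... | no _ | yes _ = refl
    ... | no _ | no v≢v = ⊥-elim (v≢v refl)

    glue-w : ∀ g W U V → glue g W U V w ≡ W
    glue-w g W U V with w ≟ u | w ≟ v | w ≟ w
    ... | yes w≡u | _ | _ = ⊥-elim (u≢w (sym w≡u))
    ... | no _ | yes w≡v | _ = ⊥-elim (v≢w (sym w≡v))
    ... | no _ | no _ | yes _ = refl
    ... | no _ | no _ | no w≢w = ⊥-elim (w≢w refl)

    glue-S′ : ∀ g W U V {z} → z ∈ S′ → z ≢ w → glue g W U V z ≡ g z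
    glue-S′ g W U V {z} z∈S′ z≢w with z ≟ u | z ≟ v | z ≟ w
    ... | yes z≡u | _ | _ = ⊥-elim (proj₁ (∈S′⁻ z∈S′) z≡u)
    ... | no _ | yes z≡v | _ = ⊥-elim (proj₂ (∈S′⁻ z∈S′) z≡v)
    ... | no _ | no _ | yes z≡w = ⊥-elim (z≢w z≡w)
    ... | no _ | no _ | no _ = refl

    glue-avoids : ∀ F X g W U V → Avoiding G S′ (F [w≔ X ]) g → Apart W (F w) →
      (∀ b → b ∈ S′ → adj w b ≡ true → Apart W (g b)) →
      Apart U (F u ∪ W) → Apart V (F v ∪ U) → Avoiding G ⊤ F (glue g W U V)
    glue-avoids F X g W U V g-avoids W#Fw W#nbrs U# V# a b (_ , _ , ab) =
      apart⇒∩≡⊥ (at (place a) (place b) ab)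
      where
      f = glue g W U V
      old : ∀ {a b} → a ∈ S′ → b ∈ S′ → b ≢ w → adj a b ≡ true → Apart (g b) (F b ∪ g a)
      old {a} {b} a∈S′ b∈S′ b≢w ab =
        subst (λ L → Apart (g b) (L ∪ g a)) (≔-off-w F X b≢w) (∩≡⊥⇒apart (g-avoids a b (a∈S′ , b∈S′ , ab)))
      at : ∀ {a b} → Place a → Place b → adj a b ≡ true → Apart (f b) (F b ∪ f a)
      at at-u at-u ab = ⊥-elim (adj⇒≢ ab refl)
      at at-v at-u _ rewrite glue-u g W U V | glue-v g W U V =
        apart-∪ (apart-∪ˡ U#) (apart-sym (apart-∪ʳ V#))
      at at-w at-u _ rewrite glue-u g W U V | glue-w g W U V = U#
      at (elsewhere a∈S′ a≢w) at-u ab = ⊥-elim ([ proj₂ (∈S′⁻ a∈S′) , a≢w ]′ (nbr-u (adj-sym ab)))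
      at at-u at-v _ rewrite glue-u g W U V | glue-v g W U V = V#
      at at-v at-v ab = ⊥-elim (adj⇒≢ ab refl)
      at at-w at-v ab = ⊥-elim (u≢w (sym (nbr-v (adj-sym ab))))
      at (elsewhere a∈S′ _) at-v ab = ⊥-elim (proj₁ (∈S′⁻ a∈S′) (nbr-v (adj-sym ab)))
      at at-u at-w _ rewrite glue-u g W U V | glue-w g W U V = apart-∪ W#Fw (apart-sym (apart-∪ʳ U#))
      at at-v at-w ab = ⊥-elim (u≢w (sym (nbr-v ab)))
      at at-w at-w ab = ⊥-elim (adj⇒≢ ab refl)
      at (elsewhere {a} a∈S′ a≢w) at-w ab rewrite glue-w g W U V | glue-S′ g W U V a∈S′ a≢w =
        apart-∪ W#Fw (W#nbrs a a∈S′ (adj-sym ab))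
      at at-u (elsewhere b∈S′ b≢w) ab = ⊥-elim ([ proj₂ (∈S′⁻ b∈S′) , b≢w ]′ (nbr-u ab))
      at at-v (elsewhere b∈S′ _) ab = ⊥-elim (proj₁ (∈S′⁻ b∈S′) (nbr-v ab))
      at at-w (elsewhere {b} b∈S′ b≢w) wb rewrite glue-w g W U V | glue-S′ g W U V b∈S′ b≢w =
        apart-∪ (apart-∪ˡ (old w∈S′ b∈S′ b≢w wb)) (apart-sym (W#nbrs b b∈S′ wb))
      at (elsewhere a∈S′ a≢w) (elsewhere b∈S′ b≢w) ab
        rewrite glue-S′ g W U V a∈S′ a≢w | glue-S′ g W U V b∈S′ b≢w = old a∈S′ b∈S′ b≢w ab

    glue-sizes : ∀ g₁ g₂ W₁ W₂ U₁ U₂ V₁ V₂ →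
      (∀ z → z ∈ S′ → ∣ g₁ z ∣ + ∣ g₂ z ∣ + 2 * deg G S′ z + 2 * ind G I′ z ≡ 16) →
      ∣ W₁ ∣ + ∣ W₂ ∣ + 2 * deg G ⊤ w ≡ 16 → ∣ U₁ ∣ + ∣ U₂ ∣ ≡ 12 → ∣ V₁ ∣ + ∣ V₂ ∣ ≡ 14 →
      ∀ z → z ∈ ⊤ →
      ∣ glue g₁ W₁ U₁ V₁ z ∣ + ∣ glue g₂ W₂ U₂ V₂ z ∣ + 2 * deg G ⊤ z + 2 * ind G I′ z ≡ 16
    glue-sizes g₁ g₂ W₁ W₂ U₁ U₂ V₁ V₂ old sW sU sV z _ with place z
    ... | at-u rewrite glue-u g₁ W₁ U₁ V₁ | glue-u g₂ W₂ U₂ V₂ | deg-u | ind-u | sU = refl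
    ... | at-v rewrite glue-v g₁ W₁ U₁ V₁ | glue-v g₂ W₂ U₂ V₂ | proj₂ leaf-v | ind-v | sV = refl
    ... | at-w rewrite glue-w g₁ W₁ U₁ V₁ | glue-w g₂ W₂ U₂ V₂ | ind-w = trans (+-identityʳ _) sW
    ... | elsewhere z∈S′ z≢w
      rewrite glue-S′ g₁ W₁ U₁ V₁ z∈S′ z≢w | glue-S′ g₂ W₂ U₂ V₂ z∈S′ z≢w | sym (deg-S′ z∈S′ z≢w) =
        old z z∈S′

    -- Colour sets for w, given colourings g₁, g₂ of G′, with the properties needed to
    -- colour u and v afterwards.
    record ColoursAtW (F g₁ g₂ : Fin n → Colors) : Set where
      field
        W₁ W₂ : Colors
        W₁#list : Apart W₁ (F w)
        W₂#list : Apart W₂ (F w)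
        W₁#nbrs : ∀ b → b ∈ S′ → adj w b ≡ true → Apart W₁ (g₁ b)
        W₂#nbrs : ∀ b → b ∈ S′ → adj w b ≡ true → Apart W₂ (g₂ b)
        size : ∣ W₁ ∣ + ∣ W₂ ∣ + 2 * deg G ⊤ w ≡ 16
        hits : ∣ W₁ ∩ F v ∣ + ∣ W₂ ∩ F v ∣ ≤ 2
        room : ∣ F u ∪ W₁ ∣ + ∣ F u ∪ W₂ ∣ ≤ 16

    list≤ : ∀ {F} → Obeys G ⊤ M′ F → ∀ z k → k ≤ deg G ⊤ z → ∣ F z ∣ ≤ 6 ∸ 2 * k
    list≤ {F} (size-ok , _) z k k≤deg =
      m+n≤o⇒m≤o∸n (∣ F z ∣) (≤-trans (+-monoʳ-≤ (∣ F z ∣) (*-monoʳ-≤ 2 k≤deg)) (size-ok z ∈⊤))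

    list-u≤2 : ∀ {F} → Obeys G ⊤ M′ F → ∣ F u ∣ ≤ 2
    list-u≤2 ob = list≤ ob u 2 (≤-reflexive (sym deg-u))

    list-v≤4 : ∀ {F} → Obeys G ⊤ M′ F → ∣ F v ∣ ≤ 4
    list-v≤4 ob = list≤ ob v 1 (≤-reflexive (sym (proj₂ leaf-v)))

    list-v#list-u : ∀ {F} → Obeys G ⊤ M′ F → Apart (F v) (F u)
    list-v#list-u (_ , leaf-ok , _) = ∩≡⊥⇒apart (leaf-ok v u leaf-v (∈⊤ , ∈⊤ , adj-sym uv))

    complete : ∀ F → Obeys G ⊤ M′ F → ∀ X (g : TwoColourings S′ (F [w≔ X ])) →
      ColoursAtW F (TwoColourings.f₁ g) (TwoColourings.f₂ g) → TwoColourings ⊤ F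
    complete F ob X g cw = record
      { f₁ = glue f₁ W₁ U₁ V₁ ; f₂ = glue f₂ W₂ U₂ V₂
      ; avoid₁ = glue-avoids F X f₁ W₁ U₁ V₁ avoid₁ W₁#list W₁#nbrs U₁-apart V₁-apart
      ; avoid₂ = glue-avoids F X f₂ W₂ U₂ V₂ avoid₂ W₂#list W₂#nbrs U₂-apart V₂-apart
      ; sizes = glue-sizes f₁ f₂ W₁ W₂ U₁ U₂ V₁ V₂ sizes size ∣U∣ ∣V∣ }
      where
      open TwoColourings g
      open ColoursAtW cw
      open PendantColours (pendantColours (F u) (F v) W₁ W₂ (list-v#list-u ob)
                             (list-v≤4 ob) hits room)

    record Plan (F : Fin n → Colors) : Set where
      field
        X : Colors
        obeys-X : Obeys G S′ M′ (F [w≔ X ])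
        colour-w : (g : TwoColourings S′ (F [w≔ X ])) →
                   ColoursAtW F (TwoColourings.f₁ g) (TwoColourings.f₂ g)

    module _ {F′ : Fin n → Colors} (g : TwoColourings S′ F′) where
      open TwoColourings g

      -- w ∉ I′, so the colourings of G′ give w exactly 16 - 2 deg′ w colours.
      sizes-w : ∣ f₁ w ∣ + ∣ f₂ w ∣ + 2 * deg G S′ w ≡ 16
      sizes-w = trans (sym (+-identityʳ _))
                  (subst (λ i → ∣ f₁ w ∣ + ∣ f₂ w ∣ + 2 * deg G S′ w + 2 * i ≡ 16) ind-w (sizes w w∈S′))

      sizes≤12 : ∀ z → z ∈ S′ → 2 ≤ deg G S′ z → ∣ f₁ z ∣ + ∣ f₂ z ∣ ≤ 12
      sizes≤12 z z∈S′ 2≤deg = +-cancelʳ-≤ 4 _ 12 (begin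
        ∣ f₁ z ∣ + ∣ f₂ z ∣ + 4 ≤⟨ +-monoʳ-≤ (∣ f₁ z ∣ + ∣ f₂ z ∣) (*-monoʳ-≤ 2 2≤deg) ⟩
        ∣ f₁ z ∣ + ∣ f₂ z ∣ + 2 * deg G S′ z ≤⟨ m≤m+n _ _ ⟩
        ∣ f₁ z ∣ + ∣ f₂ z ∣ + 2 * deg G S′ z + 2 * ind G I′ z ≡⟨ sizes z z∈S′ ⟩
        16 ∎)
        where open ≤-Reasoning

    w-avoids : ∀ {F X g} → Avoiding G S′ (F [w≔ X ]) g → ∀ {x} → x ∈ S′ → adj w x ≡ true →
               Apart (g w) (X ∪ g x)
    w-avoids {F} {X} {g} avoids {x} x∈S′ wx =
      subst (λ L → Apart (g w) (L ∪ g x)) (≔-at-w F X) (∩≡⊥⇒apart (avoids x w (x∈S′ , w∈S′ , adj-sym wx)))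

    fromFewHits : ∀ {F} → Obeys G ⊤ M′ F → ∀ {g₁ g₂ Y₁ Y₂} t → FewHits Y₁ Y₂ (F v) t 2 →
      Apart Y₁ (F w) → Apart Y₂ (F w) →
      (∀ b → b ∈ S′ → adj w b ≡ true → Apart Y₁ (g₁ b)) →
      (∀ b → b ∈ S′ → adj w b ≡ true → Apart Y₂ (g₂ b)) →
      t + 2 * deg G ⊤ w ≡ 16 → t ≤ 12 → ColoursAtW F g₁ g₂
    fromFewHits {F} ob t few Y₁# Y₂# Y₁#nbrs Y₂#nbrs t+2deg t≤12 = record
      { W₁ = W₁ ; W₂ = W₂ ; W₁#list = Y₁# ∘ W₁⊆Y₁ ; W₂#list = Y₂# ∘ W₂⊆Y₂
      ; W₁#nbrs = λ b b∈S′ wb → Y₁#nbrs b b∈S′ wb ∘ W₁⊆Y₁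
      ; W₂#nbrs = λ b b∈S′ wb → Y₂#nbrs b b∈S′ wb ∘ W₂⊆Y₂
      ; size = trans (cong (_+ 2 * deg G ⊤ w) size) t+2deg ; hits = hits
      ; room = begin
          ∣ F u ∪ W₁ ∣ + ∣ F u ∪ W₂ ∣ ≤⟨ +-mono-≤ (∣p∪q∣≤∣p∣+∣q∣ (F u) W₁) (∣p∪q∣≤∣p∣+∣q∣ (F u) W₂) ⟩
          (∣ F u ∣ + ∣ W₁ ∣) + (∣ F u ∣ + ∣ W₂ ∣) ≡⟨ interchange (∣ F u ∣) _ _ _ ⟩
          (∣ F u ∣ + ∣ F u ∣) + (∣ W₁ ∣ + ∣ W₂ ∣) ≤⟨ +-mono-≤ (+-mono-≤ (list-u≤2 ob) (list-u≤2 ob)) (≤-trans (≤-reflexive size) t≤12) ⟩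
          16 ∎ }
      where
      open ≤-Reasoning
      open FewHits few

    module Prescribed (F : Fin n → Colors) (ob : Obeys G ⊤ M′ F) where

      -- deg′ w = 0: w is a leaf of G.  Keep X = ∅ (w is isolated in G′) and give w the
      -- colours Wᵢ = F u ∪ Cᵢ, where the Cᵢ avoid F w ∪ F u and rarely meet F v.
      module Isolated (d′≡0 : deg G S′ w ≡ 0) where

        deg≡1 : deg G ⊤ w ≡ 1
        deg≡1 = trans deg-w (cong suc d′≡0)

        Fw#Fu : Apart (F w) (F u)
        Fw#Fu = ∩≡⊥⇒apart (proj₁ (proj₂ ob) w u (∈⊤ , deg≡1) (∈⊤ , ∈⊤ , adj-sym uw))

        no-nbrs : ∀ b → b ∈ S′ → adj w b ≡ true → ∀ {A B : Colors} → Apart A B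
        no-nbrs b b∈S′ wb = ⊥-elim (<-irrefl (sym d′≡0) (member⇒∣∣>0 (S′ ∩ nbhd G w) (adj⇒∈nbhd b∈S′ wb)))

        -- The colours free for the Cᵢ; t is their total size, so that ∣ W₁ ∣ + ∣ W₂ ∣ = 14.
        Y : Colors
        Y = ∁ (F w ∪ F u)

        t : ℕ
        t = 14 ∸ (∣ F u ∣ + ∣ F u ∣)

        2p+t : (∣ F u ∣ + ∣ F u ∣) + t ≡ 14
        2p+t = m+[n∸m]≡n (≤-trans (+-mono-≤ (list-u≤2 ob) (list-u≤2 ob)) (m≤m+n 4 10))

        ∣Y∣+∣Fw∪Fu∣ : ∣ Y ∣ + (∣ F w ∣ + ∣ F u ∣) ≡ 14
        ∣Y∣+∣Fw∪Fu∣ = trans (cong (∣ Y ∣ +_) (sym (∣p∪q∣-apart (F w) (F u) Fw#Fu))) (∣∁p∣+∣p∣ (F w ∪ F u))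

        ∣Y∣≤ : ∣ Y ∣ ≤ ∣ Y ─ F v ∣ + 4
        ∣Y∣≤ = subst (_≤ ∣ Y ─ F v ∣ + 4) (∣p─q∣+∣p∩q∣ Y (F v))
                 (+-monoʳ-≤ (∣ Y ─ F v ∣) (≤-trans (∣p∩q∣≤∣q∣ Y (F v)) (list-v≤4 ob)))

        room : t ≤ ∣ Y ∣ + ∣ Y ∣ × t ≤ ∣ Y ─ F v ∣ + ∣ Y ─ F v ∣ + 2
        room = leafCase-room ∣Y∣+∣Fw∪Fu∣ (list≤ ob w 1 (≤-reflexive (sym deg≡1))) ∣Y∣≤ 2p+t

        open FewHits (fewHits Y Y (F v) t 2 (proj₁ room) (proj₂ room))
          renaming (W₁ to C₁; W₂ to C₂; W₁⊆Y₁ to C₁⊆Y; W₂⊆Y₂ to C₂⊆Y)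

        C#Fw : ∀ {C} → C ⊆ Y → Apart (F u ∪ C) (F w)
        C#Fw C⊆Y m z = [ (λ a∈Fu → apart-sym Fw#Fu a∈Fu z) , (λ c∈C → x∈∁p⇒x∉p (C⊆Y c∈C) (x∈p∪q⁺ (inj₁ z))) ]′
                         (x∈p∪q⁻ (F u) _ m)

        ∣Fu∪C∣ : ∀ {C} → C ⊆ Y → ∣ F u ∪ C ∣ ≡ ∣ F u ∣ + ∣ C ∣
        ∣Fu∪C∣ {C} C⊆Y = ∣p∪q∣-apart (F u) C (λ z c∈C → x∈∁p⇒x∉p (C⊆Y c∈C) (x∈p∪q⁺ (inj₂ z)))

        -- F u contributes no colours of F v, since the lists of u and v are apart.
        hits≤ : ∀ C → ∣ (F u ∪ C) ∩ F v ∣ ≤ ∣ C ∩ F v ∣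
        hits≤ C = p⊆q⇒∣p∣≤∣q∣ λ m → let (a , b) = x∈p∩q⁻ (F u ∪ C) (F v) m in
          [ (λ a∈Fu → ⊥-elim (list-v#list-u ob b a∈Fu)) , (λ a∈C → x∈p∩q⁺ (a∈C , b)) ]′ (x∈p∪q⁻ (F u) C a)

        ∣Fu∪W∣≤ : ∀ C → ∣ F u ∪ (F u ∪ C) ∣ ≤ ∣ F u ∪ C ∣
        ∣Fu∪W∣≤ C = p⊆q⇒∣p∣≤∣q∣ λ m → [ p⊆p∪q C , (λ z → z) ]′ (x∈p∪q⁻ (F u) (F u ∪ C) m)

        ∣W∣ : ∣ F u ∪ C₁ ∣ + ∣ F u ∪ C₂ ∣ ≡ 14
        ∣W∣ = begin-equality
          ∣ F u ∪ C₁ ∣ + ∣ F u ∪ C₂ ∣ ≡⟨ cong₂ _+_ (∣Fu∪C∣ C₁⊆Y) (∣Fu∪C∣ C₂⊆Y) ⟩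
          (∣ F u ∣ + ∣ C₁ ∣) + (∣ F u ∣ + ∣ C₂ ∣) ≡⟨ interchange (∣ F u ∣) _ _ _ ⟩
          (∣ F u ∣ + ∣ F u ∣) + (∣ C₁ ∣ + ∣ C₂ ∣) ≡⟨ cong ((∣ F u ∣ + ∣ F u ∣) +_) size ⟩
          (∣ F u ∣ + ∣ F u ∣) + t ≡⟨ 2p+t ⟩
          14 ∎
          where open ≤-Reasoning

        colours : ∀ g₁ g₂ → ColoursAtW F g₁ g₂
        colours g₁ g₂ = record
          { W₁ = F u ∪ C₁ ; W₂ = F u ∪ C₂ ; W₁#list = C#Fw C₁⊆Y ; W₂#list = C#Fw C₂⊆Y
          ; W₁#nbrs = λ b b∈S′ wb → no-nbrs b b∈S′ wb ; W₂#nbrs = λ b b∈S′ wb → no-nbrs b b∈S′ wb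
          ; size = subst (λ d → ∣ F u ∪ C₁ ∣ + ∣ F u ∪ C₂ ∣ + 2 * d ≡ 16) (sym deg≡1) (cong (_+ 2) ∣W∣)
          ; hits = ≤-trans (+-mono-≤ (hits≤ C₁) (hits≤ C₂)) hits
          ; room = ≤-trans (+-mono-≤ (∣Fu∪W∣≤ C₁) (∣Fu∪W∣≤ C₂)) (≤-trans (≤-reflexive ∣W∣) (m≤m+n 14 2)) }

        plan : Plan F
        plan = record
          { X = ⊥
          ; obeys-X = obeys′ F ob ⊥
              (subst (λ d → ∣ ⊥ {14} ∣ + 2 * d ≤ 6) (sym d′≡0) (subst (λ k → k + 0 ≤ 6) (sym (∣⊥∣≡0 14)) z≤n))
              (λ b leaf-w _ → ⊥-elim (1≢0 (trans (sym (proj₂ leaf-w)) d′≡0)))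
              (λ b _ → ≤-trans (∣p∩q∣≤∣p∣ ⊥ (F b)) (≤-trans (≤-reflexive (∣⊥∣≡0 14)) z≤n))
          ; colour-w = λ g → colours (TwoColourings.f₁ g) (TwoColourings.f₂ g) }

      -- deg′ w = 1, with neighbour x in G′ (not a leaf of G, as w is no support vertex).
      -- Reserve for w in G′ a list X ⊆ (F w ∪ F v) ─ F x of at most 4 colours leaving at
      -- most 2 colours of F w ∪ F v; then colours of w in G′ rarely meet F v.
      module OneNeighbour (d′≡1 : deg G S′ w ≡ 1) where

        open Singleton (∣∣≡1⇒singleton (S′ ∩ nbhd G w) d′≡1) renaming (elem to x; elem∈ to x∈; only to only-x)

        x∈S′ : x ∈ S′
        x∈S′ = proj₁ (∈nbhd⇒adj x∈)

        wx : adj w x ≡ true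
        wx = proj₂ (∈nbhd⇒adj x∈)

        deg≡2 : deg G ⊤ w ≡ 2
        deg≡2 = trans deg-w (cong suc d′≡1)

        ∣Fw∣≤2 : ∣ F w ∣ ≤ 2
        ∣Fw∣≤2 = list≤ ob w 2 (≤-reflexive (sym deg≡2))

        Fw∪Fv : Colors
        Fw∪Fv = F w ∪ F v

        open Reservation (reserve Fw∪Fv (F x) 4 2 (list≤ ob x 2 (nbr-w-deg≥2 wx))
                            (≤-trans (∣p∪q∣≤∣p∣+∣q∣ (F w) (F v)) (+-mono-≤ ∣Fw∣≤2 (list-v≤4 ob))))

        -- w is a leaf of G′, so its partner in M′ would be a saturated support vertex.
        unmatched : ∀ b → M′ w b ≡ true → ∣ X ∩ F b ∣ ≤ 1
        unmatched b wb = let (_ , b∈S′ , adj-wb) = M′-edge wb in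
          ⊥-elim (unsaturated′ b (b∈S′ , w , (b∈S′ , w∈S′ , adj-sym adj-wb) , (w∈S′ , d′≡1))
                   (w , trans (IsMatching.msym matching′ b w) wb))

        obeys-X : Obeys G S′ M′ (F [w≔ X ])
        obeys-X = obeys′ F ob X (subst (λ d → ∣ X ∣ + 2 * d ≤ 6) (sym d′≡1) (+-monoˡ-≤ 2 ∣X∣≤K))
          (λ b _ (_ , b∈S′ , wb) → subst (λ y → X ∩ F y ≡ ⊥) (sym (only-x (adj⇒∈nbhd b∈S′ wb)))
             (apart⇒∩≡⊥ (λ m → proj₂ (x∈p─q⁻ Fw∪Fv (F x) (X⊆B─Z m)))))
          unmatched

        module _ (g : TwoColourings S′ (F [w≔ X ])) where
          open TwoColourings g

          Y₁ Y₂ : Colors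
          Y₁ = ∁ (F w ∪ f₁ x)
          Y₂ = ∁ (F w ∪ f₂ x)

          Y#Fw : ∀ {h : Colors} → Apart (∁ (F w ∪ h)) (F w)
          Y#Fw m z = x∈∁p⇒x∉p m (x∈p∪q⁺ (inj₁ z))

          Y#nbr : ∀ {h : Fin n → Colors} b → b ∈ S′ → adj w b ≡ true → Apart (∁ (F w ∪ h x)) (h b)
          Y#nbr {h} b b∈S′ wb m z =
            x∈∁p⇒x∉p m (x∈p∪q⁺ (inj₂ (subst (λ y → _ ∈ h y) (only-x (adj⇒∈nbhd b∈S′ wb)) z)))

          -- x has degree ≥ 2 in G′, so it uses at most 12 colours in total.
          room : 12 ≤ ∣ Y₁ ∣ + ∣ Y₂ ∣
          room = complementsRoom (F w ∪ f₁ x) (F w ∪ f₂ x) 12 (begin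
            ∣ F w ∪ f₁ x ∣ + ∣ F w ∪ f₂ x ∣ + 12
              ≤⟨ +-monoˡ-≤ 12 (+-mono-≤ (∣p∪q∣≤∣p∣+∣q∣ (F w) (f₁ x)) (∣p∪q∣≤∣p∣+∣q∣ (F w) (f₂ x))) ⟩
            (∣ F w ∣ + ∣ f₁ x ∣) + (∣ F w ∣ + ∣ f₂ x ∣) + 12 ≡⟨ cong (_+ 12) (interchange (∣ F w ∣) _ _ _) ⟩
            (∣ F w ∣ + ∣ F w ∣) + (∣ f₁ x ∣ + ∣ f₂ x ∣) + 12
              ≤⟨ +-monoˡ-≤ 12 (+-mono-≤ (+-mono-≤ ∣Fw∣≤2 ∣Fw∣≤2) (sizes≤12 g x x∈S′ 2≤deg′)) ⟩
            28 ∎)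
            where
            open ≤-Reasoning
            2≤deg′ : 2 ≤ deg G S′ x
            2≤deg′ = subst (2 ≤_) (sym (deg-S′ x∈S′ (λ x≡w → adj⇒≢ wx (sym x≡w)))) (nbr-w-deg≥2 wx)

          -- Colours of w outside F w ∪ F v lie in Yᵢ ─ F v; inside it they can only be
          -- among the ≤ 2 colours not reserved in X.
          outside-Fw∪Fv : ∀ {h : Fin n → Colors} → Apart (h w) (X ∪ h x) → h w ─ Fw∪Fv ⊆ ∁ (F w ∪ h x) ─ F v
          outside-Fw∪Fv {h} hw# m = let (c∈hw , c∉B) = x∈p─q⁻ (h w) Fw∪Fv m in
            x∈p∧x∉q⇒x∈p─q
              (x∉p⇒x∈∁p λ z → [ (λ c∈Fw → c∉B (x∈p∪q⁺ (inj₁ c∈Fw))) , apart-∪ʳ hw# c∈hw ]′ (x∈p∪q⁻ (F w) (h x) z))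
              (λ c∈Fv → c∉B (x∈p∪q⁺ (inj₂ c∈Fv)))

          inside-Fw∪Fv≤2 : ∀ {h : Fin n → Colors} → Apart (h w) (X ∪ h x) → ∣ h w ∩ Fw∪Fv ∣ ≤ 2
          inside-Fw∪Fv≤2 {h} hw# = ≤-trans (p⊆q⇒∣p∣≤∣q∣ λ m → let (a , b) = x∈p∩q⁻ (h w) Fw∪Fv m in
                                 x∈p∧x∉q⇒x∈p─q b (apart-∪ˡ hw# a)) ∣B─X∣≤h

          colours : ColoursAtW F f₁ f₂
          colours = fromFewHits ob 12
            (fewHits Y₁ Y₂ (F v) 12 2 room
              (roomOutside (f₁ w) (f₂ w) Fw∪Fv Y₁ Y₂ (F v) 12 (outside-Fw∪Fv {f₁} hw₁#) (outside-Fw∪Fv {f₂} hw₂#)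
                 (inside-Fw∪Fv≤2 {f₁} hw₁#) (inside-Fw∪Fv≤2 {f₂} hw₂#) (+-cancelʳ-≡ 2 _ 14 (subst (λ d → ∣ f₁ w ∣ + ∣ f₂ w ∣ + 2 * d ≡ 16) d′≡1 (sizes-w g)))))
            Y#Fw Y#Fw (Y#nbr {f₁}) (Y#nbr {f₂}) (cong (λ d → 12 + 2 * d) deg≡2) ≤-refl
            where
            hw₁# : Apart (f₁ w) (X ∪ f₁ x)
            hw₁# = w-avoids {F} {X} avoid₁ x∈S′ wx
            hw₂# : Apart (f₂ w) (X ∪ f₂ x)
            hw₂# = w-avoids {F} {X} avoid₂ x∈S′ wx

        plan : Plan F
        plan = record { X = X ; obeys-X = obeys-X ; colour-w = colours }

      -- deg′ w = 2, with neighbours x₁, x₂ in G′; then deg w = 3 and F w = ∅.  Reserve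
      -- for w in G′ a list X ⊆ F v, avoiding the list of w's partner in M′, of at most 2
      -- colours and leaving at most 2 colours of F v.
      module TwoNeighbours (d′≡2 : deg G S′ w ≡ 2) where

        open Doubleton (∣∣≡2⇒doubleton (S′ ∩ nbhd G w) d′≡2)
          renaming (first to x₁; second to x₂; first∈ to x₁∈; second∈ to x₂∈; only to only-x₁x₂)

        deg≡3 : deg G ⊤ w ≡ 3
        deg≡3 = trans deg-w (cong suc d′≡2)

        Fw#any : ∀ {A : Colors} → Apart A (F w)
        Fw#any m z = <-irrefl refl (≤-trans (member⇒∣∣>0 (F w) z) (list≤ ob w 3 (≤-reflexive (sym deg≡3))))

        -- The list of w's partner in M′ (empty if w is unmatched).
        partnerList : Colors
        partnerList with M′ w x₁ | M′ w x₂
        ... | true | _ = F x₁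
        ... | false | true = F x₂
        ... | false | false = ⊥

        ∣partnerList∣≤2 : ∣ partnerList ∣ ≤ 2
        ∣partnerList∣≤2 with M′ w x₁ | M′ w x₂
        ... | true | _ = list≤ ob x₁ 2 (nbr-w-deg≥2 (proj₂ (∈nbhd⇒adj x₁∈)))
        ... | false | true = list≤ ob x₂ 2 (nbr-w-deg≥2 (proj₂ (∈nbhd⇒adj x₂∈)))
        ... | false | false = ≤-trans (≤-reflexive (∣⊥∣≡0 14)) z≤n

        -- A partner of w in M′ is a neighbour in G′, hence x₁ or x₂.
        partner⊆ : ∀ b → M′ w b ≡ true → F b ⊆ partnerList
        partner⊆ b wb with M′-edge wb
        ... | _ , b∈S′ , adj-wb with only-x₁x₂ (adj⇒∈nbhd b∈S′ adj-wb) | M′ w x₁ in q₁ | M′ w x₂ in q₂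
        ...   | _ | true | _ = subst (λ y → F y ⊆ F x₁) (IsMatching.unique matching′ w x₁ b q₁ wb) (λ m → m)
        ...   | inj₁ refl | false | _ = ⊥-elim (true≢false (trans (sym wb) q₁))
        ...   | inj₂ refl | false | true = λ m → m
        ...   | inj₂ refl | false | false = ⊥-elim (true≢false (trans (sym wb) q₂))

        open Reservation (reserve (F v) partnerList 2 2 ∣partnerList∣≤2 (list-v≤4 ob))

        obeys-X : Obeys G S′ M′ (F [w≔ X ])
        obeys-X = obeys′ F ob X (subst (λ d → ∣ X ∣ + 2 * d ≤ 6) (sym d′≡2) (+-monoˡ-≤ 4 ∣X∣≤K))
          (λ b leaf-w _ → ⊥-elim (1≢2 (trans (sym (proj₂ leaf-w)) d′≡2)))
          (λ b wb → ≤-trans (≤-reflexive (apart⇒∣∩∣≡0 X (F b)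
                       (λ m z → proj₂ (x∈p─q⁻ (F v) partnerList (X⊆B─Z m)) (partner⊆ b wb z)))) z≤n)

        module _ (g : TwoColourings S′ (F [w≔ X ])) where
          open TwoColourings g

          Y : (Fin n → Colors) → Colors
          Y h = ∁ (h x₁ ∪ h x₂)

          Y#nbr : ∀ (h : Fin n → Colors) b → b ∈ S′ → adj w b ≡ true → Apart (Y h) (h b)
          Y#nbr h b b∈S′ wb m z with only-x₁x₂ (adj⇒∈nbhd b∈S′ wb)
          ... | inj₁ refl = x∈∁p⇒x∉p m (x∈p∪q⁺ (inj₁ z))
          ... | inj₂ refl = x∈∁p⇒x∉p m (x∈p∪q⁺ (inj₂ z))

          hw⊆Y : ∀ {h} → Avoiding G S′ (F [w≔ X ]) h → h w ⊆ Y h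
          hw⊆Y {h} avoids m = x∉p⇒x∈∁p λ z →
            [ apart-∪ʳ (w-avoids {F} {X} avoids (proj₁ (∈nbhd⇒adj x₁∈)) (proj₂ (∈nbhd⇒adj x₁∈))) m
            , apart-∪ʳ (w-avoids {F} {X} avoids (proj₁ (∈nbhd⇒adj x₂∈)) (proj₂ (∈nbhd⇒adj x₂∈))) m
            ]′ (x∈p∪q⁻ (h x₁) (h x₂) z)

          -- Colours of w avoid X, so they meet F v only in the ≤ 2 colours of F v ─ X.
          hits≤2 : ∀ {h} → Avoiding G S′ (F [w≔ X ]) h → ∣ h w ∩ F v ∣ ≤ 2
          hits≤2 {h} avoids = ≤-trans (p⊆q⇒∣p∣≤∣q∣ λ m → let (a , b) = x∈p∩q⁻ (h w) (F v) m in
            x∈p∧x∉q⇒x∈p─q b (apart-∪ˡ (w-avoids {F} {X} avoids (proj₁ (∈nbhd⇒adj x₁∈)) (proj₂ (∈nbhd⇒adj x₁∈))) a))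
            ∣B─X∣≤h

          ∣hw∣ : ∣ f₁ w ∣ + ∣ f₂ w ∣ ≡ 12
          ∣hw∣ = +-cancelʳ-≡ 4 _ 12 (subst (λ d → ∣ f₁ w ∣ + ∣ f₂ w ∣ + 2 * d ≡ 16) d′≡2 (sizes-w g))

          colours : ColoursAtW F f₁ f₂
          colours = fromFewHits ob 10
            (fewHits (Y f₁) (Y f₂) (F v) 10 2
              (≤-trans (m≤n+m 10 2) (≤-trans (≤-reflexive (sym ∣hw∣))
                 (+-mono-≤ (p⊆q⇒∣p∣≤∣q∣ (hw⊆Y avoid₁)) (p⊆q⇒∣p∣≤∣q∣ (hw⊆Y avoid₂)))))
              (roomOutside (f₁ w) (f₂ w) (F v) (Y f₁) (Y f₂) (F v) 10
                 (─-monoˡ (F v) (hw⊆Y avoid₁)) (─-monoˡ (F v) (hw⊆Y avoid₂))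
                 (hits≤2 avoid₁) (hits≤2 avoid₂) ∣hw∣))
            Fw#any Fw#any (Y#nbr f₁) (Y#nbr f₂) (cong (λ d → 10 + 2 * d) deg≡3) (m≤m+n 10 2)

        plan : Plan F
        plan = record { X = X ; obeys-X = obeys-X ; colour-w = colours }

      plan : Plan F
      plan with deg G S′ w in d′
      ... | 0 = Isolated.plan d′
      ... | 1 = OneNeighbour.plan d′
      ... | 2 = TwoNeighbours.plan d′
      ... | suc (suc (suc _)) = ⊥-elim (<-irrefl refl (≤-trans (s≤s (s≤s (s≤s z≤n))) (subst (_≤ 2) d′ deg′-w≤2)))

    tractable :
      (∀ (F : Fin n → Colors) → Obeys G S′ M′ F →
         ∃[ f₁ ] ∃[ f₂ ] (Avoiding G S′ F f₁ × Avoiding G S′ F f₂ ×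
           (∀ z → z ∈ S′ → ∣ f₁ z ∣ + ∣ f₂ z ∣ + 2 * deg G S′ z + 2 * ind G I′ z ≡ 16))) →
      Tractable G ⊤ M′ I′
    tractable colour′ = matching , unsaturated , indep , colourable
      where
      colourable : ∀ F → Obeys G ⊤ M′ F →
         ∃[ f₁ ] ∃[ f₂ ] (Avoiding G ⊤ F f₁ × Avoiding G ⊤ F f₂ ×
           (∀ z → z ∈ ⊤ → ∣ f₁ z ∣ + ∣ f₂ z ∣ + 2 * deg G ⊤ z + 2 * ind G I′ z ≡ 16))
      colourable F ob = f₁ , f₂ , avoid₁ , avoid₂ , sizes
        where
        open Plan (Prescribed.plan F ob)
        g : TwoColourings S′ (F [w≔ X ])
        g = let (h₁ , h₂ , a₁ , a₂ , s) = colour′ (F [w≔ X ]) obeys-X in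
            record { f₁ = h₁ ; f₂ = h₂ ; avoid₁ = a₁ ; avoid₂ = a₂ ; sizes = s }
        open TwoColourings (complete F ob X g (colour-w g))

lemma23 : ∀ {n : ℕ} (G : Graph n) →
    Connected G → MaxDeg≤3 G → ¬ IsPath G →
    ∀ (u v w : Fin n) → v ≢ w →
    Graph.adj G u v ≡ true → Graph.adj G u w ≡ true →
    deg G ⊤ u ≡ 2 → Leaf G ⊤ v → ¬ Support G ⊤ w →
    ∀ (M′ : Fin n → Fin n → Bool) (I′ : Subset n) →
    Tractable G ((⊤ - u) - v) M′ I′ →
    ∃[ M ] Tractable G ⊤ M I′
lemma23 G _ maxDeg _ u v w v≢w uv uw deg-u leaf-v w-noSupport M′ I′
        (matching′ , unsaturated′ , indep′ , colour′) =
  M′ , Extension.tractable M′ I′ matching′ unsaturated′ indep′ colour′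
  where open PendantPath G maxDeg u v w v≢w uv uw deg-u leaf-v w-noSupport
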